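{- For a graph $G$ on $n$ vertices, $\operatorname{bal}(G)$ divides the index $|S_n:\mathrm{Aut}(G)|$.
   Context: Identify $G$ with its adjacency matrix on vertex set $[n]$; $(G^\sigma)_{ij}=G_{\sigma(i)\sigma(j)}$ for $\sigma\in S_n$, and $\mathrm{Aut}(G)=\{\sigma\in S_n:G^\sigma=G\}$. $\operatorname{bal}(G)$ is the least positive value of $\sum_\sigma c_\sigma$ over integer families $(c_\sigma)$ with $\sum_\sigma c_\sigma G^\sigma\in\{aI+bJ:a,b\in\mathbb{Z}\}$. -}

module Defs where

open import Data.Bool using (Bool; true; false; _∧_; if_then_else_)
open import Data.Nat as ℕ using (ℕ; zero; suc)
open import Data.Integer as ℤ using (ℤ; +_; 0ℤ; 1ℤ)
open import Data.Fin using (Fin; _≟_)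
open import Data.Fin.Permutation using (Permutation′; _⟨$⟩ʳ_)
open import Data.Vec using (Vec; []; _∷_; lookup)
open import Data.List using (List; []; _∷_; [_]; map; concatMap; allFin; filterᵇ; length; foldr)
open import Data.Product using (_×_; _,_; Σ; ∃; ∃-syntax)
open import Relation.Binary.PropositionalEquality using (_≡_)
open import Relation.Nullary.Decidable using (⌊_⌋)

record Graph (n : ℕ) : Set where
  field
    adj   : Fin n → Fin n → Bool
    sym   : ∀ i j → adj i j ≡ adj j i
    irrefl : ∀ i → adj i i ≡ false
open Graph public

Perm : ℕ → Set
Perm n = Permutation′ n

A : ∀ {n} → Graph n → Fin n → Fin n → ℤ
A G i j = if adj G i j then 1ℤ else 0ℤ

Aσ : ∀ {n} → Graph n → Perm n → Fin n → Fin n → ℤ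
Aσ G σ i j = A G (σ ⟨$⟩ʳ i) (σ ⟨$⟩ʳ j)

-- A finitely supported integer family (c_σ)_{σ ∈ S_n}, represented as a list
-- of (σ , c) pairs (repeated σ's add up).
Family : ℕ → Set
Family n = List (Perm n × ℤ)

combo : ∀ {n} → Graph n → Family n → Fin n → Fin n → ℤ
combo G L i j = foldr (λ { (σ , c) acc → c ℤ.* Aσ G σ i j ℤ.+ acc }) 0ℤ L

total : ∀ {n} → Family n → ℤ
total L = foldr (λ { (σ , c) acc → c ℤ.+ acc }) 0ℤ L

δ : ∀ {n} → Fin n → Fin n → ℤ
δ i j = if ⌊ i ≟ j ⌋ then 1ℤ else 0ℤ

InSpanIJ : ∀ {n} → (Fin n → Fin n → ℤ) → Set
InSpanIJ M = ∃[ a ] ∃[ b ] (∀ i j → M i j ≡ a ℤ.* δ i j ℤ.+ b)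

Achieves : ∀ {n} → Graph n → ℤ → Set
Achieves G v = Σ (Family _) λ L → InSpanIJ (combo G L) × total L ≡ v

IsBal : ∀ {n} → Graph n → ℕ → Set
IsBal G b = (1 ℕ.≤ b) × Achieves G (+ b) × (∀ v → 1 ℕ.≤ v → Achieves G (+ v) → b ℕ.≤ v)

allᵇ : {X : Set} → (X → Bool) → List X → Bool
allᵇ p = foldr (λ x acc → p x ∧ acc) true

allVecs : (n m : ℕ) → List (Vec (Fin n) m)
allVecs n zero = [ [] ]
allVecs n (suc m) = concatMap (λ v → map (_∷ v) (allFin n)) (allVecs n m)

-- A map [n] → [n] (as a vector) is a bijection (injective suffices on a finite set).
isBijᵇ : ∀ {n} → Vec (Fin n) n → Bool
isBijᵇ {n} v = allᵇ (λ i → allᵇ (λ j → if ⌊ lookup v i ≟ lookup v j ⌋ then ⌊ i ≟ j ⌋ else true) (allFin n)) (allFin n)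

isAutᵇ : ∀ {n} → Graph n → Vec (Fin n) n → Bool
isAutᵇ {n} G v = allᵇ (λ i → allᵇ (λ j → eqB (adj G (lookup v i) (lookup v j)) (adj G i j)) (allFin n)) (allFin n)
  where
  eqB : Bool → Bool → Bool
  eqB true true = true
  eqB false false = true
  eqB _ _ = false

autCount : ∀ {n} → Graph n → ℕ
autCount {n} G = length (filterᵇ (λ v → isBijᵇ v ∧ isAutᵇ G v) (allVecs n n))

module Submission where

-- The permutations σ with a given relabelling G^σ form a coset of Aut(G), so S_n splits
-- into m = |S_n : Aut(G)| classes of size |Aut(G)|, on each of which G^σ is constant. Choosing the
-- least permutation of each class (in an enumeration of S_n by Fin (n !)) gives a family R with
-- Σ_{σ ∈ S_n} G^σ = |Aut(G)| · Σ_{σ ∈ R} G^σ. As S_n is 2-transitive on the vertices, the left side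
-- vanishes on the diagonal and is constant off it, so Σ_{σ ∈ R} G^σ lies in {aI + bJ} and m = |R| is
-- an achievable value of Σ c_σ. Achievable values form a subgroup of ℤ, whose least positive element
-- bal(G) divides all of them.

open import Defs hiding (sym)

-- ℤ arithmetic is confined to this block, so that _*_ in the final statement is that of ℕ.
module _ where

  open import Data.Bool as Bool using (Bool; true; false; T; if_then_else_)
  open import Data.Bool.Properties using (T-∧)
  open import Data.Fin using (Fin; Fin′; zero; suc; inject; fromℕ<; punchIn; punchOut; combine; remQuot; _≟_; _<_)
  open import Data.Fin.Permutation as Perm
    using ( Permutation; Permutation′; permutation; _⟨$⟩ʳ_; _⟨$⟩ˡ_; _≈_; _∘ₚ_; flip
          ; insert; remove; insert-remove; remove-insert)
  import Data.Fin.Permutation.Components as PC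
  open import Data.Fin.Properties
    using ( punchInᵢ≢i; punchOut-cong; punchOut-injective; remQuot-combine; combine-remQuot; injective⇒≤
          ; toℕ-injective; toℕ-inject; toℕ-fromℕ<; <-cmp; any?; all?; ¬∀⟶∃¬; ¬∀⟶∃¬-smallest)
  open import Data.Integer using (ℤ; +_; 0ℤ; 1ℤ; _+_; _*_; -_)
  open import Data.Integer.Properties
    using ( +-*-semiring; +-identityˡ; +-identityʳ; +-assoc; +-inverseˡ; *-identityˡ; *-identityʳ; *-zeroʳ
          ; *-assoc; *-comm; *-distribˡ-+; *-cancelˡ-≡; *-commutativeSemigroup; pos-+; pos-*)
  open import Data.Integer.Tactic.RingSolver using (solve-∀)
  open import Algebra.Properties.CommutativeSemigroup *-commutativeSemigroup using (x∙yz≈y∙xz)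
  open import Data.List using (List; []; _∷_; _++_; map; concatMap; tabulate; allFin; filterᵇ; length; foldr)
  open import Data.Nat as ℕ using (ℕ; zero; suc; _!)
  open import Data.Nat.DivMod using (_/_; _%_; m≡m%n+[m/n]*n; m%n<n)
  open import Data.Nat.Divisibility using (_∣_; m%n≡0⇒n∣m)
  import Data.Nat.Properties as ℕₚ
  open import Data.Product using (∃; _×_; _,_; proj₁; proj₂; uncurry; map₂)
  open import Data.Vec as Vec using (Vec; []; _∷_; lookup)
  open import Data.Vec.Properties
    using (lookup∘tabulate; tabulate∘lookup; tabulate-cong; ∷-injectiveˡ; ∷-injectiveʳ; ≡-dec)
  open import Function using (_∘_; id; _⇔_; mk⇔; Injective)
  open import Function.Bundles using (module Equivalence)
  open import Level using (0ℓ)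
  open import Relation.Binary.Core using (Rel)
  open import Relation.Binary.Definitions using (DecidableEquality; tri<; tri≈; tri>)
  open import Relation.Binary.PropositionalEquality
  open import Relation.Binary.Structures using (IsDecEquivalence)
  open import Relation.Nullary using (Dec; yes; no; does; _because_; ¬_; contradiction; _×-dec_)
  open import Relation.Nullary.Decidable
    using (T?; ⌊_⌋; ¬?; dec-true; dec-false; decidable-stable; toWitness; fromWitness)

  open import Algebra.Properties.Semiring.Sum +-*-semiring
    using (sum; sum-cong-≗; sum-remove; sum-replicate-zero; ∑-comm; ∑-distrib-+; ∑-permute; *-distribˡ-sum; *-distribʳ-sum)

  open Equivalence using (to; from)

  private variable X Y : Set

  -- Indicators and finite sums

  𝟙 : ∀ {p} {P : Set p} → Dec P → ℤ
  𝟙 P? = if does P? then 1ℤ else 0ℤ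

  𝟙-yes : ∀ {p} {P : Set p} (P? : Dec P) → P → 𝟙 P? ≡ 1ℤ
  𝟙-yes P? p = cong (if_then 1ℤ else 0ℤ) (dec-true P? p)

  𝟙-no : ∀ {p} {P : Set p} (P? : Dec P) → ¬ P → 𝟙 P? ≡ 0ℤ
  𝟙-no P? ¬p = cong (if_then 1ℤ else 0ℤ) (dec-false P? ¬p)

  𝟙-×-dec : ∀ {p q} {P : Set p} {Q : Set q} (P? : Dec P) (Q? : Dec Q) → 𝟙 (P? ×-dec Q?) ≡ 𝟙 P? * 𝟙 Q?
  𝟙-×-dec (true  because _) (true  because _) = refl
  𝟙-×-dec (true  because _) (false because _) = refl
  𝟙-×-dec (false because _) (true  because _) = refl
  𝟙-×-dec (false because _) (false because _) = refl

  𝟙-⇔ : ∀ {p q} {P : Set p} {Q : Set q} (P? : Dec P) (Q? : Dec Q) → P ⇔ Q → 𝟙 P? ≡ 𝟙 Q?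
  𝟙-⇔ P? Q? P⇔Q with P? | Q?
  ... | yes _ | yes _ = refl
  ... | no  _ | no  _ = refl
  ... | yes p | no ¬q = contradiction (to P⇔Q p) ¬q
  ... | no ¬p | yes q = contradiction (from P⇔Q q) ¬p

  sum-ones : ∀ N → sum {N} (λ _ → 1ℤ) ≡ + N
  sum-ones zero    = refl
  sum-ones (suc N) = cong (_+_ 1ℤ) (sum-ones N)

  sum-single : ∀ {N} (f : Fin N → ℤ) i → (∀ j → j ≢ i → f j ≡ 0ℤ) → sum f ≡ f i
  sum-single {suc N} f i f≡0 = begin
    sum f                                 ≡⟨ sum-remove {i = i} f ⟩
    f i + sum (λ k → f (punchIn i k))     ≡⟨ cong (_+_ (f i)) (sum-cong-≗ (λ k → f≡0 _ (punchInᵢ≢i i k))) ⟩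
    f i + sum {N} (λ _ → 0ℤ)              ≡⟨ cong (_+_ (f i)) (sum-replicate-zero N) ⟩
    f i + 0ℤ                              ≡⟨ +-identityʳ (f i) ⟩
    f i                                   ∎
    where open ≡-Reasoning

  sumˡ : (X → ℤ) → List X → ℤ
  sumˡ f = foldr (λ x s → f x + s) 0ℤ

  sumˡ-cong : ∀ {f g : X → ℤ} → (∀ x → f x ≡ g x) → ∀ xs → sumˡ f xs ≡ sumˡ g xs
  sumˡ-cong f≗g []       = refl
  sumˡ-cong f≗g (x ∷ xs) = cong₂ _+_ (f≗g x) (sumˡ-cong f≗g xs)

  sumˡ-++ : ∀ (f : X → ℤ) xs ys → sumˡ f (xs ++ ys) ≡ sumˡ f xs + sumˡ f ys
  sumˡ-++ f []       ys = sym (+-identityˡ _)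
  sumˡ-++ f (x ∷ xs) ys = trans (cong (_+_ (f x)) (sumˡ-++ f xs ys)) (sym (+-assoc (f x) _ _))

  sumˡ-map : ∀ (f : Y → ℤ) (g : X → Y) xs → sumˡ f (map g xs) ≡ sumˡ (f ∘ g) xs
  sumˡ-map f g []       = refl
  sumˡ-map f g (x ∷ xs) = cong (_+_ (f (g x))) (sumˡ-map f g xs)

  sumˡ-concatMap : ∀ (f : Y → ℤ) (g : X → List Y) xs → sumˡ f (concatMap g xs) ≡ sumˡ (sumˡ f ∘ g) xs
  sumˡ-concatMap f g []       = refl
  sumˡ-concatMap f g (x ∷ xs) = trans (sumˡ-++ f (g x) (concatMap g xs)) (cong (_+_ (sumˡ f (g x))) (sumˡ-concatMap f g xs))

  sumˡ-*ˡ : ∀ c (f : X → ℤ) xs → sumˡ (λ x → c * f x) xs ≡ c * sumˡ f xs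
  sumˡ-*ˡ c f []       = sym (*-zeroʳ c)
  sumˡ-*ˡ c f (x ∷ xs) = trans (cong (_+_ (c * f x)) (sumˡ-*ˡ c f xs)) (sym (*-distribˡ-+ c (f x) _))

  sumˡ-tabulate : ∀ {N} (f : X → ℤ) (g : Fin N → X) → sumˡ f (tabulate g) ≡ sum (f ∘ g)
  sumˡ-tabulate {N = zero}  f g = refl
  sumˡ-tabulate {N = suc N} f g = cong (_+_ (f (g zero))) (sumˡ-tabulate f (g ∘ suc))

  sumˡ-sum : ∀ {N} (f : X → Fin N → ℤ) xs → sumˡ (λ x → sum (f x)) xs ≡ sum (λ k → sumˡ (λ x → f x k) xs)
  sumˡ-sum {N = N} f []       = sym (sum-replicate-zero N)
  sumˡ-sum         f (x ∷ xs) = trans (cong (_+_ (sum (f x))) (sumˡ-sum f xs)) (sym (∑-distrib-+ (f x) _))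

  length-filterᵇ : ∀ (p : X → Bool) xs → + length (filterᵇ p xs) ≡ sumˡ (𝟙 ∘ T? ∘ p) xs
  length-filterᵇ p []       = refl
  length-filterᵇ p (x ∷ xs) with p x
  ... | true  = cong (_+_ 1ℤ) (length-filterᵇ p xs)
  ... | false = trans (length-filterᵇ p xs) (sym (+-identityˡ _))

  T-allᵇ-tabulate : ∀ {n} (p : X → Bool) (g : Fin n → X) → T (allᵇ p (tabulate g)) ⇔ (∀ i → T (p (g i)))
  T-allᵇ-tabulate {n = zero}  p g = mk⇔ (λ _ ()) _
  T-allᵇ-tabulate {n = suc n} p g = mk⇔
    (λ t → λ { zero → proj₁ (to T-∧ t) ; (suc i) → to (T-allᵇ-tabulate p (g ∘ suc)) (proj₂ (to T-∧ t)) i })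
    (λ t → from T-∧ (t zero , from (T-allᵇ-tabulate p (g ∘ suc)) (t ∘ suc)))

  T-allᵇ-allFin : ∀ {n} (p : Fin n → Bool) → T (allᵇ p (allFin n)) ⇔ (∀ i → T (p i))
  T-allᵇ-allFin p = T-allᵇ-tabulate p id

  T-implication : ∀ {p q} {P : Set p} {Q : Set q} (P? : Dec P) (Q? : Dec Q) →
    T (if ⌊ P? ⌋ then ⌊ Q? ⌋ else true) ⇔ (P → Q)
  T-implication (yes p) Q? = mk⇔ (λ t _ → toWitness t) (λ f → fromWitness (f p))
  T-implication (no ¬p) Q? = mk⇔ (λ _ p → contradiction p ¬p) _

  isBijᵇ⇔injective : ∀ {n} (v : Vec (Fin n) n) → T (isBijᵇ v) ⇔ Injective _≡_ _≡_ (lookup v)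
  isBijᵇ⇔injective v = mk⇔ injective bij
    where
    injective : T (isBijᵇ v) → Injective _≡_ _≡_ (lookup v)
    injective t {i} {j} =
      to (T-implication (lookup v i ≟ lookup v j) (i ≟ j)) (to (T-allᵇ-allFin _) (to (T-allᵇ-allFin _) t i) j)

    bij : Injective _≡_ _≡_ (lookup v) → T (isBijᵇ v)
    bij inj = from (T-allᵇ-allFin _) λ i → from (T-allᵇ-allFin _) λ j →
      from (T-implication (lookup v i ≟ lookup v j) (i ≟ j)) inj

  isAutᵇ⇔ : ∀ {n} (G : Graph n) (v : Vec (Fin n) n) →
    T (isAutᵇ G v) ⇔ (∀ i j → adj G (lookup v i) (lookup v j) ≡ adj G i j)
  isAutᵇ⇔ {n} G v = mk⇔ sound complete
    where
    -- The equality test of Bools inside isAutᵇ is local to Defs and cannot be named here, so both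
    -- directions reach it through a witness whose type Agda infers, and then split on the two Bools.
    sound : T (isAutᵇ G v) → ∀ i j → adj G (lookup v i) (lookup v j) ≡ adj G i j
    sound t i j with to (T-allᵇ-allFin _) (to (T-allᵇ-allFin _) t i) j
    ... | tᵢⱼ with adj G (lookup v i) (lookup v j) | adj G i j
    ... | true  | true  = refl
    ... | false | false = refl
    sound t i j | () | true  | false
    sound t i j | () | false | true

    complete : (∀ i j → adj G (lookup v i) (lookup v j) ≡ adj G i j) → T (isAutᵇ G v)
    complete h with T? (isAutᵇ G v)
    ... | yes t = t
    ... | no ¬t with ¬∀⟶∃¬ n _ (λ _ → T? _) (¬t ∘ from (T-allᵇ-allFin _))
    ... | i , ¬tᵢ with ¬∀⟶∃¬ n _ (λ _ → T? _) (¬tᵢ ∘ from (T-allᵇ-allFin _))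
    ... | j , ¬tᵢⱼ with adj G (lookup v i) (lookup v j) | adj G i j | h i j
    ... | true  | true  | refl = contradiction _ ¬tᵢⱼ
    ... | false | false | refl = contradiction _ ¬tᵢⱼ

  -- Permutations

  Fin-injective⇒surjective : ∀ {n} {f : Fin n → Fin n} → Injective _≡_ _≡_ f → ∀ y → ∃ λ x → f x ≡ y
  Fin-injective⇒surjective {suc n} {f} inj y with any? (λ x → f x ≟ y)
  ... | yes hit = hit
  ... | no miss = contradiction (injective⇒≤ punchOut∘f-injective) (ℕₚ.n≮n n)
    where
    y≢f : ∀ x → y ≢ f x
    y≢f x y≡fx = miss (x , sym y≡fx)

    punchOut∘f-injective : Injective _≡_ _≡_ (λ x → punchOut (y≢f x))
    punchOut∘f-injective = inj ∘ punchOut-injective (y≢f _) (y≢f _)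

  injective⇒permutation : ∀ {n} (f : Fin n → Fin n) → Injective _≡_ _≡_ f → Perm n
  injective⇒permutation f inj = permutation f (proj₁ ∘ hit) (proj₂ ∘ hit) (λ x → inj (proj₂ (hit (f x))))
    where hit = Fin-injective⇒surjective inj

  ⟨$⟩ʳ-injective : ∀ {n} (σ : Perm n) → Injective _≡_ _≡_ (σ ⟨$⟩ʳ_)
  ⟨$⟩ʳ-injective σ {i} {j} σi≡σj = begin
    i                   ≡⟨ Perm.inverseˡ σ ⟨
    σ ⟨$⟩ˡ (σ ⟨$⟩ʳ i)   ≡⟨ cong (σ ⟨$⟩ˡ_) σi≡σj ⟩
    σ ⟨$⟩ˡ (σ ⟨$⟩ʳ j)   ≡⟨ Perm.inverseˡ σ ⟩
    j                   ∎
    where open ≡-Reasoning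

  vec : ∀ {n} → Perm n → Vec (Fin n) n
  vec σ = Vec.tabulate (σ ⟨$⟩ʳ_)

  vec-≈ : ∀ {n} {σ τ : Perm n} → vec σ ≡ vec τ → σ ≈ τ
  vec-≈ {σ = σ} {τ} eq i = begin
    σ ⟨$⟩ʳ i            ≡⟨ lookup∘tabulate (σ ⟨$⟩ʳ_) i ⟨
    lookup (vec σ) i    ≡⟨ cong (λ v → lookup v i) eq ⟩
    lookup (vec τ) i    ≡⟨ lookup∘tabulate (τ ⟨$⟩ʳ_) i ⟩
    τ ⟨$⟩ʳ i            ∎
    where open ≡-Reasoning

  isBijᵇ-vec : ∀ {n} (σ : Perm n) → T (isBijᵇ (vec σ))
  isBijᵇ-vec σ = from (isBijᵇ⇔injective (vec σ)) λ {i} {j} eq →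
    ⟨$⟩ʳ-injective σ (trans (sym (lookup∘tabulate _ i)) (trans eq (lookup∘tabulate _ j)))

  isBijᵇ⇒vec : ∀ {n} (v : Vec (Fin n) n) → T (isBijᵇ v) → ∃ λ σ → vec σ ≡ v
  isBijᵇ⇒vec v t = injective⇒permutation (lookup v) (to (isBijᵇ⇔injective v) t) , tabulate∘lookup v

  transpose-matchˡ : ∀ {n} (i j : Fin n) → PC.transpose i j i ≡ j
  transpose-matchˡ i j rewrite dec-true (i ≟ i) refl = refl

  transpose-other : ∀ {n} {i j k : Fin n} → k ≢ i → k ≢ j → PC.transpose i j k ≡ k
  transpose-other {i = i} {j} {k} k≢i k≢j rewrite dec-false (k ≟ i) k≢i | dec-false (k ≟ j) k≢j = refl

  perm-2-transitive : ∀ {n} {x y x′ y′ : Fin n} → x ≢ y → x′ ≢ y′ →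
    ∃ λ τ → τ ⟨$⟩ʳ x ≡ x′ × τ ⟨$⟩ʳ y ≡ y′
  perm-2-transitive {x = x} {y} {x′} {y′} x≢y x′≢y′ = τ₁ ∘ₚ τ₂ , τx≡x′ , transpose-matchˡ y₁ y′
    where
    τ₁ = Perm.transpose x x′
    y₁ = τ₁ ⟨$⟩ʳ y
    τ₂ = Perm.transpose y₁ y′
    x′≢y₁ : x′ ≢ y₁
    x′≢y₁ x′≡y₁ = x≢y (⟨$⟩ʳ-injective τ₁ (trans (transpose-matchˡ x x′) x′≡y₁))
    τx≡x′ : τ₂ ⟨$⟩ʳ (τ₁ ⟨$⟩ʳ x) ≡ x′
    τx≡x′ = trans (cong (τ₂ ⟨$⟩ʳ_) (transpose-matchˡ x x′)) (transpose-other x′≢y₁ x′≢y′)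

  -- S (n + 1) ≅ Fin (n + 1) × S n by σ ↦ (σ 0 , σ with 0 removed), and combine/remQuot identify
  -- Fin (n + 1) × Fin (n !) with Fin ((n + 1) !).
  perm : ∀ n → Fin (n !) → Perm n
  perm zero    _ = Perm.id
  perm (suc n) k = uncurry (λ i k′ → insert zero i (perm n k′)) (remQuot (n !) k)

  permIndex : ∀ n → Perm n → Fin (n !)
  permIndex zero    _ = zero
  permIndex (suc n) σ = combine (σ ⟨$⟩ʳ zero) (permIndex n (remove zero σ))

  perm-combine : ∀ n i k → perm (suc n) (combine i k) ≡ insert zero i (perm n k)
  perm-combine n i k = cong (uncurry (λ i k′ → insert zero i (perm n k′))) (remQuot-combine i k)

  punchOut-cong₂ : ∀ {n} {i i′ j j′ : Fin (suc n)} (i≢j : i ≢ j) (i′≢j′ : i′ ≢ j′) →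
    i ≡ i′ → j ≡ j′ → punchOut i≢j ≡ punchOut i′≢j′
  punchOut-cong₂ {i = i} _ _ refl refl = punchOut-cong i refl

  remove-cong : ∀ {m n} i {σ τ : Permutation (suc m) (suc n)} → σ ≈ τ → remove i σ ≈ remove i τ
  remove-cong i σ≈τ j = punchOut-cong₂ _ _ (σ≈τ i) (σ≈τ (punchIn i j))

  insert-cong : ∀ {m n} i j {π ρ : Permutation m n} → π ≈ ρ → insert i j π ≈ insert i j ρ
  insert-cong i j π≈ρ k with i ≟ k
  ... | yes _ = refl
  ... | no  _ = cong (punchIn j) (π≈ρ _)

  permIndex-cong : ∀ n {σ τ : Perm n} → σ ≈ τ → permIndex n σ ≡ permIndex n τ
  permIndex-cong zero    _   = refl
  permIndex-cong (suc n) {σ} {τ} σ≈τ = cong₂ combine (σ≈τ zero) (permIndex-cong n (remove-cong zero {σ} {τ} σ≈τ))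

  permIndex-perm : ∀ n k → permIndex n (perm n k) ≡ k
  permIndex-perm zero    zero = refl
  permIndex-perm (suc n) k    = begin
    combine i (permIndex n (remove zero (insert zero i (perm n k′))))
      ≡⟨ cong (combine i) (permIndex-cong n (remove-insert zero i (perm n k′))) ⟩
    combine i (permIndex n (perm n k′))
      ≡⟨ cong (combine i) (permIndex-perm n k′) ⟩
    combine i k′
      ≡⟨ combine-remQuot (n !) k ⟩
    k ∎
    where
    open ≡-Reasoning
    i  = proj₁ (remQuot (n !) k)
    k′ = proj₂ (remQuot (n !) k)

  perm-permIndex : ∀ n (σ : Perm n) → perm n (permIndex n σ) ≈ σ
  perm-permIndex zero    σ ()
  perm-permIndex (suc n) σ j = begin
    perm (suc n) (combine (σ ⟨$⟩ʳ zero) (permIndex n σ′)) ⟨$⟩ʳ j  ≡⟨ cong (_⟨$⟩ʳ j) (perm-combine n _ _) ⟩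
    insert zero (σ ⟨$⟩ʳ zero) (perm n (permIndex n σ′)) ⟨$⟩ʳ j   ≡⟨ insert-cong zero _ (perm-permIndex n σ′) j ⟩
    insert zero (σ ⟨$⟩ʳ zero) σ′ ⟨$⟩ʳ j                           ≡⟨ insert-remove zero σ j ⟩
    σ ⟨$⟩ʳ j                                                      ∎
    where
    open ≡-Reasoning
    σ′ = remove zero σ

  permIndex-∘ₚ-cancel : ∀ {n} (β γ : Perm n) → (∀ i → γ ⟨$⟩ʳ (β ⟨$⟩ʳ i) ≡ i) →
    ∀ k → permIndex n (β ∘ₚ perm n (permIndex n (γ ∘ₚ perm n k))) ≡ k
  permIndex-∘ₚ-cancel {n} β γ γβ≗id k = trans
    (permIndex-cong n (λ i → trans (perm-permIndex n (γ ∘ₚ perm n k) (β ⟨$⟩ʳ i)) (cong (perm n k ⟨$⟩ʳ_) (γβ≗id i))))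
    (permIndex-perm n k)

  sum-∘ₚ : ∀ {n} (α : Perm n) (F : Perm n → ℤ) → (∀ {σ τ} → σ ≈ τ → F σ ≡ F τ) →
    sum (F ∘ perm n) ≡ sum (λ k → F (α ∘ₚ perm n k))
  sum-∘ₚ {n} α F F-cong = begin
    sum (F ∘ perm n)
      ≡⟨ ∑-permute (F ∘ perm n) translate ⟩
    sum (λ k → F (perm n (permIndex n (α ∘ₚ perm n k))))
      ≡⟨ sum-cong-≗ (λ k → F-cong (perm-permIndex n (α ∘ₚ perm n k))) ⟩
    sum (λ k → F (α ∘ₚ perm n k)) ∎
    where
    open ≡-Reasoning
    translate : Permutation′ (n !)
    translate = permutation (λ k → permIndex n (α ∘ₚ perm n k)) (λ k → permIndex n (flip α ∘ₚ perm n k))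
      (permIndex-∘ₚ-cancel α (flip α) (λ _ → Perm.inverseˡ α))
      (permIndex-∘ₚ-cancel (flip α) α (λ _ → Perm.inverseʳ α))

  -- Counting automorphisms

  sumˡ-allVecs-suc : ∀ n m (h : Vec (Fin n) (suc m) → ℤ) →
    sumˡ h (allVecs n (suc m)) ≡ sumˡ (λ v → sum (λ x → h (x ∷ v))) (allVecs n m)
  sumˡ-allVecs-suc n m h = trans (sumˡ-concatMap h _ (allVecs n m))
    (sumˡ-cong (λ v → trans (sumˡ-map h (_∷ v) (allFin n)) (sumˡ-tabulate (h ∘ (_∷ v)) id)) (allVecs n m))

  sumˡ-allVecs-single : ∀ {n} m (w : Vec (Fin n) m) (h : Vec (Fin n) m → ℤ) →
    (∀ v → v ≢ w → h v ≡ 0ℤ) → sumˡ h (allVecs n m) ≡ h w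
  sumˡ-allVecs-single zero    []      h h≡0 = +-identityʳ (h [])
  sumˡ-allVecs-single {n} (suc m) (x ∷ w) h h≡0 = begin
    sumˡ h (allVecs n (suc m))
      ≡⟨ sumˡ-allVecs-suc n m h ⟩
    sumˡ (λ v → sum (λ y → h (y ∷ v))) (allVecs n m)
      ≡⟨ sumˡ-allVecs-single m w _ row≡0 ⟩
    sum (λ y → h (y ∷ w))
      ≡⟨ sum-single _ x (λ y y≢x → h≡0 (y ∷ w) (y≢x ∘ ∷-injectiveˡ)) ⟩
    h (x ∷ w) ∎
    where
    open ≡-Reasoning
    row≡0 : ∀ v → v ≢ w → sum (λ y → h (y ∷ v)) ≡ 0ℤ
    row≡0 v v≢w = trans (sum-cong-≗ (λ y → h≡0 (y ∷ v) (v≢w ∘ ∷-injectiveʳ))) (sum-replicate-zero n)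

  _≟ᵥ_ : ∀ {n m} → DecidableEquality (Vec (Fin n) m)
  _≟ᵥ_ = ≡-dec _≟_

  vec-perm-count : ∀ {n} (v : Vec (Fin n) n) → sum (λ k → 𝟙 (vec (perm n k) ≟ᵥ v)) ≡ 𝟙 (T? (isBijᵇ v))
  vec-perm-count {n} v with T? (isBijᵇ v)
  ... | yes t = trans (sum-single _ (permIndex n σ) others≡0)
    (trans (𝟙-yes (vec (perm n (permIndex n σ)) ≟ᵥ v) vec-σ) (sym (𝟙-yes (T? (isBijᵇ v)) t)))
    where
    σ = proj₁ (isBijᵇ⇒vec v t)
    vec-σ : vec (perm n (permIndex n σ)) ≡ v
    vec-σ = trans (tabulate-cong (perm-permIndex n σ)) (proj₂ (isBijᵇ⇒vec v t))
    others≡0 : ∀ k → k ≢ permIndex n σ → 𝟙 (vec (perm n k) ≟ᵥ v) ≡ 0ℤ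
    others≡0 k k≢ = 𝟙-no (vec (perm n k) ≟ᵥ v) λ eq → k≢ (trans (sym (permIndex-perm n k))
      (permIndex-cong n (vec-≈ {σ = perm n k} {σ} (trans eq (sym (proj₂ (isBijᵇ⇒vec v t)))))))
  ... | no ¬t = trans (sum-cong-≗ none) (trans (sum-replicate-zero (n !)) (sym (𝟙-no (T? (isBijᵇ v)) ¬t)))
    where
    none : ∀ k → 𝟙 (vec (perm n k) ≟ᵥ v) ≡ 0ℤ
    none k = 𝟙-no (vec (perm n k) ≟ᵥ v) λ eq → ¬t (subst (T ∘ isBijᵇ) eq (isBijᵇ-vec (perm n k)))

  autCount≡sum : ∀ {n} (G : Graph n) → + autCount G ≡ sum (λ k → 𝟙 (T? (isAutᵇ G (vec (perm n k)))))
  autCount≡sum {n} G = begin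
    + autCount G
      ≡⟨ length-filterᵇ _ (allVecs n n) ⟩
    sumˡ (λ v → 𝟙 (T? (isBijᵇ v) ×-dec T? (isAutᵇ G v))) (allVecs n n)
      ≡⟨ sumˡ-cong (λ v → trans (𝟙-×-dec (T? (isBijᵇ v)) (T? (isAutᵇ G v)))
                                 (cong (_* aut v) (sym (vec-perm-count v)))) (allVecs n n) ⟩
    sumˡ (λ v → sum (λ k → 𝟙 (vec (perm n k) ≟ᵥ v)) * aut v) (allVecs n n)
      ≡⟨ sumˡ-cong (λ v → *-distribʳ-sum (aut v) (λ k → 𝟙 (vec (perm n k) ≟ᵥ v))) (allVecs n n) ⟩
    sumˡ (λ v → sum (λ k → 𝟙 (vec (perm n k) ≟ᵥ v) * aut v)) (allVecs n n)
      ≡⟨ sumˡ-sum (λ v k → 𝟙 (vec (perm n k) ≟ᵥ v) * aut v) (allVecs n n) ⟩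
    sum (λ k → sumˡ (λ v → 𝟙 (vec (perm n k) ≟ᵥ v) * aut v) (allVecs n n))
      ≡⟨ sum-cong-≗ (λ k → sumˡ-allVecs-single n (vec (perm n k)) (λ v → 𝟙 (vec (perm n k) ≟ᵥ v) * aut v)
            λ v v≢ → cong (_* aut v) (𝟙-no (vec (perm n k) ≟ᵥ v) (v≢ ∘ sym))) ⟩
    sum (λ k → 𝟙 (vec (perm n k) ≟ᵥ vec (perm n k)) * aut (vec (perm n k)))
      ≡⟨ sum-cong-≗ (λ k → trans (cong (_* aut (vec (perm n k))) (𝟙-yes (vec (perm n k) ≟ᵥ vec (perm n k)) refl))
                                  (*-identityˡ _)) ⟩
    sum (λ k → aut (vec (perm n k)))  ∎
    where
    open ≡-Reasoning
    aut : Vec (Fin n) n → ℤ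
    aut v = 𝟙 (T? (isAutᵇ G v))

  -- Least representatives of a decidable equivalence

  inject-fromℕ< : ∀ {n} {i j : Fin n} (i<j : i < j) → inject {i = j} (fromℕ< i<j) ≡ i
  inject-fromℕ< i<j = toℕ-injective (trans (toℕ-inject (fromℕ< i<j)) (toℕ-fromℕ< i<j))

  module LeastRepresentatives {N ℓ} {_~_ : Rel (Fin N) ℓ} (isDecEquivalence : IsDecEquivalence _~_) where

    open IsDecEquivalence isDecEquivalence
      renaming (_≟_ to _~?_; refl to ~-refl; sym to ~-sym; trans to ~-trans)

    IsLeast : Fin N → Set ℓ
    IsLeast j = (i : Fin′ j) → ¬ inject i ~ j

    isLeast? : ∀ j → Dec (IsLeast j)
    isLeast? j = all? (λ i → ¬? (inject i ~? j))

    least-exists : ∀ k → ∃ λ j → IsLeast j × k ~ j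
    least-exists k with ¬∀⟶∃¬-smallest N (λ j → ¬ j ~ k) (λ j → ¬? (j ~? k)) (λ ≁k → ≁k k ~-refl)
    ... | j , ¬≁k , earlier≁k = j , (λ i i~j → earlier≁k i (~-trans i~j j~k)) , ~-sym j~k
      where
      j~k : j ~ k
      j~k = decidable-stable (j ~? k) ¬≁k

    least-unique : ∀ {j j′} → IsLeast j → IsLeast j′ → j ~ j′ → j ≡ j′
    least-unique {j} {j′} least least′ j~j′ with <-cmp j j′
    ... | tri< j<j′ _ _ = contradiction (subst (_~ j′) (sym (inject-fromℕ< j<j′)) j~j′) (least′ (fromℕ< j<j′))
    ... | tri≈ _ j≡j′ _ = j≡j′
    ... | tri> _ _ j′<j = contradiction (subst (_~ j) (sym (inject-fromℕ< j′<j)) (~-sym j~j′)) (least (fromℕ< j′<j))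

    one-least-per-class : ∀ k → sum (λ j → 𝟙 (isLeast? j) * 𝟙 (k ~? j)) ≡ 1ℤ
    one-least-per-class k = trans (sum-single _ j others≡0)
      (trans (sym (𝟙-×-dec (isLeast? j) (k ~? j))) (𝟙-yes (isLeast? j ×-dec k ~? j) (least , k~j)))
      where
      j = proj₁ (least-exists k)
      least = proj₁ (proj₂ (least-exists k))
      k~j = proj₂ (proj₂ (least-exists k))
      others≡0 : ∀ j′ → j′ ≢ j → 𝟙 (isLeast? j′) * 𝟙 (k ~? j′) ≡ 0ℤ
      others≡0 j′ j′≢j = trans (sym (𝟙-×-dec (isLeast? j′) (k ~? j′))) (𝟙-no (isLeast? j′ ×-dec k ~? j′)
        λ (least′ , k~j′) → j′≢j (least-unique least′ least (~-trans (~-sym k~j′) k~j)))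

    sum-by-least : ∀ f → sum f ≡ sum (λ j → 𝟙 (isLeast? j) * sum (λ k → 𝟙 (k ~? j) * f k))
    sum-by-least f = begin
      sum f
        ≡⟨ sum-cong-≗ (λ k → trans (sym (*-identityˡ (f k))) (cong (_* f k) (sym (one-least-per-class k)))) ⟩
      sum (λ k → sum (λ j → 𝟙L j * 𝟙 (k ~? j)) * f k)
        ≡⟨ sum-cong-≗ (λ k → *-distribʳ-sum (f k) (λ j → 𝟙L j * 𝟙 (k ~? j))) ⟩
      sum (λ k → sum (λ j → 𝟙L j * 𝟙 (k ~? j) * f k))
        ≡⟨ ∑-comm (λ k j → 𝟙L j * 𝟙 (k ~? j) * f k) ⟩
      sum (λ j → sum (λ k → 𝟙L j * 𝟙 (k ~? j) * f k))
        ≡⟨ sum-cong-≗ (λ j → trans (sum-cong-≗ (λ k → *-assoc (𝟙L j) _ (f k)))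
                                   (sym (*-distribˡ-sum (𝟙L j) (λ k → 𝟙 (k ~? j) * f k)))) ⟩
      sum (λ j → 𝟙L j * sum (λ k → 𝟙 (k ~? j) * f k)) ∎
      where
      open ≡-Reasoning
      𝟙L : Fin N → ℤ
      𝟙L j = 𝟙 (isLeast? j)

    sum-class-invariant : ∀ c (f : Fin N → ℤ) → (∀ j → sum (λ k → 𝟙 (k ~? j)) ≡ c) →
      (∀ {k j} → k ~ j → f k ≡ f j) → sum f ≡ c * sum (λ j → 𝟙 (isLeast? j) * f j)
    sum-class-invariant c f class-size f-invariant = begin
      sum f
        ≡⟨ sum-by-least f ⟩
      sum (λ j → 𝟙 (isLeast? j) * sum (λ k → 𝟙 (k ~? j) * f k))
        ≡⟨ sum-cong-≗ (λ j → cong (𝟙 (isLeast? j) *_) (class-sum j)) ⟩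
      sum (λ j → 𝟙 (isLeast? j) * (c * f j))
        ≡⟨ sum-cong-≗ (λ j → x∙yz≈y∙xz (𝟙 (isLeast? j)) c (f j)) ⟩
      sum (λ j → c * (𝟙 (isLeast? j) * f j))
        ≡⟨ *-distribˡ-sum c (λ j → 𝟙 (isLeast? j) * f j) ⟨
      c * sum (λ j → 𝟙 (isLeast? j) * f j) ∎
      where
      open ≡-Reasoning
      on-class : ∀ j k → 𝟙 (k ~? j) * f k ≡ 𝟙 (k ~? j) * f j
      on-class j k with k ~? j
      ... | yes k~j = cong (1ℤ *_) (f-invariant k~j)
      ... | no  _   = refl
      class-sum : ∀ j → sum (λ k → 𝟙 (k ~? j) * f k) ≡ c * f j
      class-sum j = begin
        sum (λ k → 𝟙 (k ~? j) * f k)  ≡⟨ sum-cong-≗ (on-class j) ⟩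
        sum (λ k → 𝟙 (k ~? j) * f j)  ≡⟨ *-distribʳ-sum (f j) (λ k → 𝟙 (k ~? j)) ⟨
        sum (λ k → 𝟙 (k ~? j)) * f j  ≡⟨ cong (_* f j) (class-size j) ⟩
        c * f j                       ∎

  -- Relabelled graphs

  infix 8 _^_
  infix 4 _≐_ _≐?_

  _^_ : ∀ {n} → Graph n → Perm n → Fin n → Fin n → Bool
  (G ^ σ) a b = adj G (σ ⟨$⟩ʳ a) (σ ⟨$⟩ʳ b)

  _≐_ : ∀ {n} → (Fin n → Fin n → Bool) → (Fin n → Fin n → Bool) → Set
  M ≐ M′ = ∀ a b → M a b ≡ M′ a b

  _≐?_ : ∀ {n} (M M′ : Fin n → Fin n → Bool) → Dec (M ≐ M′)
  M ≐? M′ = all? λ a → all? λ b → M a b Bool.≟ M′ a b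

  ^-cong : ∀ {n} (G : Graph n) {σ τ : Perm n} → σ ≈ τ → G ^ σ ≐ G ^ τ
  ^-cong G σ≈τ a b = cong₂ (adj G) (σ≈τ a) (σ≈τ b)

  isAutᵇ-vec⇔ : ∀ {n} (G : Graph n) (τ : Perm n) → T (isAutᵇ G (vec τ)) ⇔ G ^ τ ≐ adj G
  isAutᵇ-vec⇔ G τ = mk⇔
    (λ t a b → trans (sym (lookup-vec a b)) (to (isAutᵇ⇔ G (vec τ)) t a b))
    (λ aut → from (isAutᵇ⇔ G (vec τ)) λ a b → trans (lookup-vec a b) (aut a b))
    where
    lookup-vec : ∀ a b → adj G (lookup (vec τ) a) (lookup (vec τ) b) ≡ (G ^ τ) a b
    lookup-vec a b = cong₂ (adj G) (lookup∘tabulate _ a) (lookup∘tabulate _ b)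

  -- ρ ∘ₚ τ applies ρ first, so G ^ (ρ ∘ₚ τ) is G ^ τ with both indices relabelled by ρ.
  ^-∘ₚ-≐⇔ : ∀ {n} (G : Graph n) (ρ τ : Perm n) → G ^ (ρ ∘ₚ τ) ≐ G ^ ρ ⇔ G ^ τ ≐ adj G
  ^-∘ₚ-≐⇔ G ρ τ = mk⇔
    (λ same a b → trans (cong₂ (G ^ τ) (sym (Perm.inverseʳ ρ)) (sym (Perm.inverseʳ ρ)))
      (trans (same (ρ ⟨$⟩ˡ a) (ρ ⟨$⟩ˡ b)) (cong₂ (adj G) (Perm.inverseʳ ρ) (Perm.inverseʳ ρ))))
    (λ aut a b → aut (ρ ⟨$⟩ʳ a) (ρ ⟨$⟩ʳ b))

  -- Achievable values

  InSpanIJ-intro : ∀ {n} (M : Fin n → Fin n → ℤ) → (∀ x → M x x ≡ 0ℤ) →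
    (∀ {x y x′ y′} → x ≢ y → x′ ≢ y′ → M x y ≡ M x′ y′) → InSpanIJ M
  InSpanIJ-intro {zero}        M diag off = 0ℤ , 0ℤ , λ ()
  InSpanIJ-intro {suc zero}    M diag off = 0ℤ , 0ℤ , λ { zero zero → diag zero }
  InSpanIJ-intro {suc (suc n)} M diag off = - c , c , entry
    where
    c = M zero (suc zero)
    entry : ∀ x y → M x y ≡ - c * δ x y + c
    entry x y with x ≟ y
    ... | yes refl = trans (diag x) (sym (trans (cong (_+ c) (*-identityʳ (- c))) (+-inverseˡ c)))
    ... | no  x≢y  = trans (off x≢y (λ ())) (sym (trans (cong (_+ c) (*-zeroʳ (- c))) (+-identityˡ c)))

  module _ {n} (G : Graph n) where

    achieves-+ : ∀ {v w} → Achieves G v → Achieves G w → Achieves G (v + w)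
    achieves-+ (L , (a , b , L≡) , ΣL≡v) (L′ , (a′ , b′ , L′≡) , ΣL′≡w) =
      L ++ L′ , (a + a′ , b + b′ , entry) , trans (sumˡ-++ proj₂ L L′) (cong₂ _+_ ΣL≡v ΣL′≡w)
      where
      entry : ∀ i j → combo G (L ++ L′) i j ≡ (a + a′) * δ i j + (b + b′)
      entry i j = trans (sumˡ-++ (λ (σ , d) → d * Aσ G σ i j) L L′)
        (trans (cong₂ _+_ (L≡ i j) (L′≡ i j)) (collect a b a′ b′ (δ i j)))
        where
        collect : ∀ a b a′ b′ d → (a * d + b) + (a′ * d + b′) ≡ (a + a′) * d + (b + b′)
        collect = solve-∀

    achieves-*ˡ : ∀ c {v} → Achieves G v → Achieves G (c * v)
    achieves-*ˡ c (L , (a , b , L≡) , ΣL≡v) =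
      map (map₂ (c *_)) L , (c * a , c * b , entry) ,
      trans (sumˡ-map proj₂ (map₂ (c *_)) L) (trans (sumˡ-*ˡ c proj₂ L) (cong (c *_) ΣL≡v))
      where
      entry : ∀ i j → combo G (map (map₂ (c *_)) L) i j ≡ (c * a) * δ i j + c * b
      entry i j = begin
        combo G (map (map₂ (c *_)) L) i j                       ≡⟨ sumˡ-map (λ (σ , d) → d * Aσ G σ i j) (map₂ (c *_)) L ⟩
        sumˡ (λ (σ , d) → c * d * Aσ G σ i j) L                 ≡⟨ sumˡ-cong (λ (σ , d) → *-assoc c d (Aσ G σ i j)) L ⟩
        sumˡ (λ (σ , d) → c * (d * Aσ G σ i j)) L               ≡⟨ sumˡ-*ˡ c (λ (σ , d) → d * Aσ G σ i j) L ⟩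
        c * combo G L i j                                       ≡⟨ cong (c *_) (L≡ i j) ⟩
        c * (a * δ i j + b)                                     ≡⟨ scale c a b (δ i j) ⟩
        c * a * δ i j + c * b                                   ∎
        where
        open ≡-Reasoning
        scale : ∀ c a b d → c * (a * d + b) ≡ c * a * d + c * b
        scale = solve-∀

    IsBal⇒∣ : ∀ {b m} → IsBal G b → Achieves G (+ m) → b ∣ m
    IsBal⇒∣ {suc b′} {m} (_ , achieves-b , b-least) achieves-m = m%n≡0⇒n∣m m b r≡0
      where
      b = suc b′
      q = m / b
      r = m % b
      r-formula : + m + - + q * + b ≡ + r
      r-formula = begin
        + m + - + q * + b                ≡⟨ cong (λ z → + z + - + q * + b) (m≡m%n+[m/n]*n m b) ⟩
        + (r ℕ.+ q ℕ.* b) + - + q * + b  ≡⟨ cong (_+ - + q * + b) (trans (pos-+ r (q ℕ.* b)) (cong (_+_ (+ r)) (pos-* q b))) ⟩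
        (+ r + + q * + b) + - + q * + b  ≡⟨ cancel (+ r) (+ q) (+ b) ⟩
        + r                              ∎
        where
        open ≡-Reasoning
        cancel : ∀ r q b → (r + q * b) + - q * b ≡ r
        cancel = solve-∀
      achieves-r : Achieves G (+ r)
      achieves-r = subst (Achieves G) r-formula (achieves-+ achieves-m (achieves-*ˡ (- + q) achieves-b))
      r≡0 : r ≡ 0
      r≡0 = ℕₚ.n<1⇒n≡0 (ℕₚ.≰⇒> λ 1≤r → ℕₚ.<⇒≱ (m%n<n m b) (b-least r 1≤r achieves-r))

  -- The index is achievable

  module _ {n} (G : Graph n) where

    _~_ : Rel (Fin (n !)) 0ℓ
    k ~ j = G ^ perm n k ≐ G ^ perm n j

    ~-isDecEquivalence : IsDecEquivalence _~_
    ~-isDecEquivalence = record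
      { isEquivalence = record
        { refl  = λ _ _ → refl
        ; sym   = λ k~j a b → sym (k~j a b)
        ; trans = λ i~j j~k a b → trans (i~j a b) (j~k a b)
        }
      ; _≟_ = λ k j → G ^ perm n k ≐? G ^ perm n j
      }

    open LeastRepresentatives ~-isDecEquivalence

    ∣Aut∣ : ℤ
    ∣Aut∣ = + autCount G

    class-size : ∀ j → sum (λ k → 𝟙 (G ^ perm n k ≐? G ^ perm n j)) ≡ ∣Aut∣
    class-size j = begin
      sum (λ k → 𝟙 (G ^ perm n k ≐? G ^ ρ))
        ≡⟨ sum-∘ₚ ρ (λ σ → 𝟙 (G ^ σ ≐? G ^ ρ)) (λ {σ} {τ} → ≐ρ-resp {σ} {τ}) ⟩
      sum (λ k → 𝟙 (G ^ (ρ ∘ₚ perm n k) ≐? G ^ ρ))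
        ≡⟨ sum-cong-≗ (λ k → 𝟙-⇔ (G ^ (ρ ∘ₚ perm n k) ≐? G ^ ρ) (T? _) (aut⇔ (perm n k))) ⟩
      sum (λ k → 𝟙 (T? (isAutᵇ G (vec (perm n k)))))
        ≡⟨ autCount≡sum G ⟨
      ∣Aut∣ ∎
      where
      open ≡-Reasoning
      ρ = perm n j
      ≐ρ-resp : ∀ {σ τ} → σ ≈ τ → 𝟙 (G ^ σ ≐? G ^ ρ) ≡ 𝟙 (G ^ τ ≐? G ^ ρ)
      ≐ρ-resp {σ} {τ} σ≈τ = 𝟙-⇔ (G ^ σ ≐? G ^ ρ) (G ^ τ ≐? G ^ ρ)
        (mk⇔ (λ same a b → trans (sym (σ≐τ a b)) (same a b)) (λ same a b → trans (σ≐τ a b) (same a b)))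
        where σ≐τ = ^-cong G {σ} {τ} σ≈τ
      aut⇔ : ∀ τ → G ^ (ρ ∘ₚ τ) ≐ G ^ ρ ⇔ T (isAutᵇ G (vec τ))
      aut⇔ τ = mk⇔ (from (isAutᵇ-vec⇔ G τ) ∘ to (^-∘ₚ-≐⇔ G ρ τ))
                   (from (^-∘ₚ-≐⇔ G ρ τ) ∘ to (isAutᵇ-vec⇔ G τ))

    representatives : Family n
    representatives = tabulate (λ j → perm n j , 𝟙 (isLeast? j))

    n!≡∣Aut∣*total-representatives : + (n !) ≡ ∣Aut∣ * total representatives
    n!≡∣Aut∣*total-representatives = begin
      + (n !)
        ≡⟨ sum-ones (n !) ⟨
      sum {n !} (λ _ → 1ℤ)
        ≡⟨ sum-class-invariant ∣Aut∣ (λ _ → 1ℤ) class-size (λ _ → refl) ⟩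
      ∣Aut∣ * sum (λ j → 𝟙 (isLeast? j) * 1ℤ)
        ≡⟨ cong (∣Aut∣ *_) (sum-cong-≗ (λ j → *-identityʳ (𝟙 (isLeast? j)))) ⟩
      ∣Aut∣ * sum (λ j → 𝟙 (isLeast? j))
        ≡⟨ cong (∣Aut∣ *_) (sumˡ-tabulate proj₂ (λ j → perm n j , 𝟙 (isLeast? j))) ⟨
      ∣Aut∣ * total representatives ∎
      where open ≡-Reasoning

    imageSum : Fin n → Fin n → ℤ
    imageSum a b = sum (λ k → Aσ G (perm n k) a b)

    imageSum≡∣Aut∣*combo-representatives : ∀ a b → imageSum a b ≡ ∣Aut∣ * combo G representatives a b
    imageSum≡∣Aut∣*combo-representatives a b = trans
      (sum-class-invariant ∣Aut∣ (λ k → Aσ G (perm n k) a b) class-size (λ k~j → cong (if_then 1ℤ else 0ℤ) (k~j a b)))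
      (cong (∣Aut∣ *_) (sym (sumˡ-tabulate (λ (σ , c) → c * Aσ G σ a b) (λ j → perm n j , 𝟙 (isLeast? j)))))

    imageSum-diagonal : ∀ x → imageSum x x ≡ 0ℤ
    imageSum-diagonal x =
      trans (sum-cong-≗ (λ k → cong (if_then 1ℤ else 0ℤ) (irrefl G (perm n k ⟨$⟩ʳ x)))) (sum-replicate-zero (n !))

    imageSum-offDiagonal : ∀ {x y x′ y′} → x ≢ y → x′ ≢ y′ → imageSum x y ≡ imageSum x′ y′
    imageSum-offDiagonal {x} {y} x≢y x′≢y′ with perm-2-transitive x≢y x′≢y′
    ... | τ , τx≡x′ , τy≡y′ =
      trans (sum-∘ₚ τ (λ σ → Aσ G σ x y) (λ σ≈σ′ → cong₂ (A G) (σ≈σ′ x) (σ≈σ′ y)))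
      (sum-cong-≗ (λ k → cong₂ (λ u v → A G (perm n k ⟨$⟩ʳ u) (perm n k ⟨$⟩ʳ v)) τx≡x′ τy≡y′))

    representatives-inSpanIJ : autCount G ≢ 0 → InSpanIJ (combo G representatives)
    representatives-inSpanIJ aut≢0 = InSpanIJ-intro (combo G representatives) diagonal offDiagonal
      where
      cancel : ∀ {u v} → ∣Aut∣ * u ≡ ∣Aut∣ * v → u ≡ v
      cancel {u} {v} = *-cancelˡ-≡ ∣Aut∣ u v {{ℕ.≢-nonZero aut≢0}}
      diagonal : ∀ x → combo G representatives x x ≡ 0ℤ
      diagonal x = cancel (trans (sym (imageSum≡∣Aut∣*combo-representatives x x))
        (trans (imageSum-diagonal x) (sym (*-zeroʳ ∣Aut∣))))
      offDiagonal : ∀ {x y x′ y′} → x ≢ y → x′ ≢ y′ → combo G representatives x y ≡ combo G representatives x′ y′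
      offDiagonal x≢y x′≢y′ = cancel (trans (sym (imageSum≡∣Aut∣*combo-representatives _ _))
        (trans (imageSum-offDiagonal x≢y x′≢y′) (imageSum≡∣Aut∣*combo-representatives _ _)))

    achieves-index : ∀ {m} → m ℕ.* autCount G ≡ n ! → Achieves G (+ m)
    achieves-index {m} index = representatives , representatives-inSpanIJ aut≢0 , total≡m
      where
      aut≢0 : autCount G ≢ 0
      aut≢0 aut≡0 = ℕₚ.m<n⇒n≢0 (ℕₚ.1≤n! n) (trans (sym index) (trans (cong (m ℕ.*_) aut≡0) (ℕₚ.*-zeroʳ m)))
      total≡m : total representatives ≡ + m
      total≡m = *-cancelˡ-≡ ∣Aut∣ _ (+ m) {{ℕ.≢-nonZero aut≢0}}
        (trans (sym n!≡∣Aut∣*total-representatives) (trans (cong +_ (sym index)) (trans (pos-* m _) (*-comm (+ m) ∣Aut∣))))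

open import Data.Nat using (ℕ; _*_; _!)
open import Data.Nat.Divisibility using (_∣_)
open import Relation.Binary.PropositionalEquality using (_≡_)

lemma2p2 : (n : ℕ) (G : Graph n) (b m : ℕ) →
    IsBal G b → m * autCount G ≡ n ! → b ∣ m
lemma2p2 n G b m bal index = IsBal⇒∣ G bal (achieves-index G index)
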